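{- Assume $\Theta$ is finite. Let $\phi\in\mathcal{L}_C$ be a classical proposition such that $\vdash\Box\phi\vee\Box\neg\phi$ in DmBL. Then $\vdash_C\phi$ or $\vdash_C\neg\phi$.
   Context: Fix a set $\Theta$ of atomic propositions. $\mathcal{L}_C$ is the smallest set containing $\Theta$ and closed under $\neg\phi$ and $\phi\rightarrow\psi$; $\vdash_C$ denotes provability in classical propositional logic (axioms c1 $\phi\rightarrow(\psi\rightarrow\phi)$, c2 $(\eta\rightarrow(\phi\rightarrow\psi))\rightarrow((\eta\rightarrow\phi)\rightarrow(\eta\rightarrow\psi))$, c3 $(\neg\phi\rightarrow\neg\psi)\rightarrow((\neg\phi\rightarrow\psi)\rightarrow\phi)$, with modus ponens). The language $\mathcal{L}\supset\mathcal{L}_C$ is the smallest set containing $\Theta$ and closed under $\neg\phi$, $\Box\phi$, $\phi\rightarrow\psi$ and the conditional $(\psi|\phi)$. Abbreviations: $\phi\vee\psi=\neg\phi\rightarrow\psi$, $\phi\wedge\psi=\neg(\neg\phi\vee\neg\psi)$, $\phi\leftrightarrow\psi=(\phi\rightarrow\psi)\wedge(\psi\rightarrow\phi)$, $\top=\theta_0\rightarrow\theta_0$ for a fixed $\theta_0\in\Theta$, $\bot=\neg\top$, $\Diamond\phi=\neg\Box\neg\phi$, $\psi\times\phi=\Box\bigl((\psi|\phi)\leftrightarrow\psi\bigr)$. The theorems ($\vdash$) of DmBL are the smallest set containing all instances of the schemes c1, c2, c3, m2 $\Box(\phi\rightarrow\psi)\rightarrow(\Box\phi\rightarrow\Box\psi)$,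 m3 $\Box\phi\rightarrow\phi$, b1 $\Box(\phi\rightarrow\psi)\rightarrow(\Box\neg\phi\vee\Box(\psi|\phi))$, b2 $((\psi\rightarrow\eta)|\phi)\rightarrow((\psi|\phi)\rightarrow(\eta|\phi))$, b3 $(\psi|\phi)\rightarrow(\phi\rightarrow\psi)$, b4 $\neg(\neg\psi|\phi)\leftrightarrow(\psi|\phi)$, b5 $(\psi\times\phi)\leftrightarrow(\phi\times\psi)$, and closed under modus ponens and necessitation (from $\vdash\phi$ infer $\vdash\Box\phi$). -}

module Defs where

open import Data.Nat using (ℕ)
open import Data.Fin using (Fin)

-- Atomic propositions Θ = Fin n (finite); θ₀ ∈ Θ is a fixed atom used for ⊤.

data FormC (n : ℕ) : Set where
  atomC : Fin n → FormC n
  ¬C_   : FormC n → FormC n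
  _⇒C_  : FormC n → FormC n → FormC n

data Form (n : ℕ) : Set where
  atom : Fin n → Form n
  ¬_   : Form n → Form n
  □_   : Form n → Form n
  _⇒_  : Form n → Form n → Form n
  cond : Form n → Form n → Form n   -- cond ψ φ  is  (ψ | φ)

infixr 20 ¬_ □_ ¬C_
infixr 10 _⇒_ _⇒C_

data ⊢C_ {n : ℕ} : FormC n → Set where
  c1 : ∀ φ ψ → ⊢C (φ ⇒C (ψ ⇒C φ))
  c2 : ∀ η φ ψ → ⊢C ((η ⇒C (φ ⇒C ψ)) ⇒C ((η ⇒C φ) ⇒C (η ⇒C ψ)))
  c3 : ∀ φ ψ → ⊢C ((¬C φ ⇒C ¬C ψ) ⇒C ((¬C φ ⇒C ψ) ⇒C φ))
  mpC : ∀ {φ ψ} → ⊢C (φ ⇒C ψ) → ⊢C φ → ⊢C ψ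

emb : ∀ {n} → FormC n → Form n
emb (atomC i) = atom i
emb (¬C φ) = ¬ emb φ
emb (φ ⇒C ψ) = emb φ ⇒ emb ψ

module Abbrev {n : ℕ} (θ₀ : Fin n) where
  infixr 12 _∨_
  infixr 13 _∧_
  infix 8 _⇔_ _×'_
  infixr 20 ◇_
  infix 4 ⊢_
  _∨_ : Form n → Form n → Form n
  φ ∨ ψ = ¬ φ ⇒ ψ
  _∧_ : Form n → Form n → Form n
  φ ∧ ψ = ¬ (¬ φ ∨ ¬ ψ)
  _⇔_ : Form n → Form n → Form n
  φ ⇔ ψ = (φ ⇒ ψ) ∧ (ψ ⇒ φ)
  ⊤' : Form n
  ⊤' = atom θ₀ ⇒ atom θ₀
  ⊥' : Form n
  ⊥' = ¬ ⊤'
  ◇_ : Form n → Form n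
  ◇ φ = ¬ □ ¬ φ
  _×'_ : Form n → Form n → Form n
  ψ ×' φ = □ (cond ψ φ ⇔ ψ)

  data ⊢_ : Form n → Set where
    c1 : ∀ φ ψ → ⊢ (φ ⇒ (ψ ⇒ φ))
    c2 : ∀ η φ ψ → ⊢ ((η ⇒ (φ ⇒ ψ)) ⇒ ((η ⇒ φ) ⇒ (η ⇒ ψ)))
    c3 : ∀ φ ψ → ⊢ ((¬ φ ⇒ ¬ ψ) ⇒ ((¬ φ ⇒ ψ) ⇒ φ))
    m2 : ∀ φ ψ → ⊢ (□ (φ ⇒ ψ) ⇒ (□ φ ⇒ □ ψ))
    m3 : ∀ φ → ⊢ (□ φ ⇒ φ)
    b1 : ∀ φ ψ → ⊢ (□ (φ ⇒ ψ) ⇒ (□ ¬ φ ∨ □ cond ψ φ))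
    b2 : ∀ φ ψ η → ⊢ (cond (ψ ⇒ η) φ ⇒ (cond ψ φ ⇒ cond η φ))
    b3 : ∀ φ ψ → ⊢ (cond ψ φ ⇒ (φ ⇒ ψ))
    b4 : ∀ φ ψ → ⊢ (¬ cond (¬ ψ) φ ⇔ cond ψ φ)
    b5 : ∀ φ ψ → ⊢ ((ψ ×' φ) ⇔ (φ ×' ψ))
    mp : ∀ {φ ψ} → ⊢ (φ ⇒ ψ) → ⊢ φ → ⊢ ψ
    nec : ∀ {φ} → ⊢ φ → ⊢ □ φ

{-# OPTIONS --safe #-}

-- If φ or ¬φ is a classical tautology, Kalmár's argument proves it in ⊢C: every
-- formula is derivable with its sign from the literals of the atoms under a valuation,
-- and these hypotheses are discharged one atom at a time by case splitting.
-- Otherwise φ is contingent, true under some valuation v₁ and false under some v₀.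
-- In the two-world model whose worlds carry v₁ and v₀, where □ means truth in both
-- worlds and (ψ | φ) is read at the nearest φ-world, every theorem of DmBL is valid,
-- yet □φ ∨ □¬φ fails because φ holds in exactly one world.

module Submission where

open import Defs
open import Data.Bool using (Bool; true; false; not; if_then_else_)
  renaming (_∧_ to _∧ᵇ_; _∨_ to _∨ᵇ_)
open import Data.Bool.Properties using (not-injective; ¬-not) renaming (_≟_ to _≟ᵇ_)
open import Data.Empty using (⊥; ⊥-elim)
open import Data.Fin using (Fin; toℕ; fromℕ<)
open import Data.Fin.Properties using (toℕ-fromℕ<; toℕ<n; toℕ-injective) renaming (_≟_ to _≟ᶠ_)
open import Data.Fin.Subset.Properties using (anySubset?)
open import Data.Nat using (ℕ; zero; suc; _≤_; _<_; z≤n; _*_)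
open import Data.Nat.Properties using (≤-refl; <⇒≤; <⇒≱; ≤∧≢⇒<)
open import Data.Product using (_×_; _,_; ∃)
open import Data.Sum using (_⊎_; inj₁; inj₂)
open import Data.Vec using (Vec; []; _∷_; lookup; replicate; _[_]≔_)
open import Data.Vec.Properties using (lookup∘update; lookup∘update′)
open import Level using (0ℓ)
open import Relation.Binary.PropositionalEquality using (_≡_; refl; sym; trans; cong; cong₂; subst)
open import Relation.Nullary using (yes; no)
open import Relation.Nullary.Decidable using (False; toWitnessFalse)
open import Relation.Unary using (Pred; _∈_; _⊆_; _∪_; ｛_｝; Empty)

private
  variable
    n k : ℕ

Context : ℕ → Set₁
Context n = Pred (FormC n) 0ℓ

infixl 5 _,,_
_,,_ : Context n → FormC n → Context n
Γ ,, A = Γ ∪ ｛ A ｝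

infix 4 _⊢C_
data _⊢C_ (Γ : Context n) : FormC n → Set where
  c1  : ∀ φ ψ → Γ ⊢C φ ⇒C (ψ ⇒C φ)
  c2  : ∀ η φ ψ → Γ ⊢C (η ⇒C (φ ⇒C ψ)) ⇒C ((η ⇒C φ) ⇒C (η ⇒C ψ))
  c3  : ∀ φ ψ → Γ ⊢C (¬C φ ⇒C ¬C ψ) ⇒C ((¬C φ ⇒C ψ) ⇒C φ)
  mp  : ∀ {φ ψ} → Γ ⊢C φ ⇒C ψ → Γ ⊢C φ → Γ ⊢C ψ
  hyp : ∀ {φ} → φ ∈ Γ → Γ ⊢C φ

private
  variable
    Γ Δ : Context n
    A B φ : FormC n

⊢C-weaken : Γ ⊆ Δ → Γ ⊢C φ → Δ ⊢C φ
⊢C-weaken Γ⊆Δ (c1 φ ψ)   = c1 φ ψ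
⊢C-weaken Γ⊆Δ (c2 η φ ψ) = c2 η φ ψ
⊢C-weaken Γ⊆Δ (c3 φ ψ)   = c3 φ ψ
⊢C-weaken Γ⊆Δ (mp d e)   = mp (⊢C-weaken Γ⊆Δ d) (⊢C-weaken Γ⊆Δ e)
⊢C-weaken Γ⊆Δ (hyp φ∈Γ)  = hyp (Γ⊆Δ φ∈Γ)

⊢C-from-empty : Empty Γ → Γ ⊢C φ → ⊢C φ
⊢C-from-empty empty (c1 φ ψ)   = c1 φ ψ
⊢C-from-empty empty (c2 η φ ψ) = c2 η φ ψ
⊢C-from-empty empty (c3 φ ψ)   = c3 φ ψ
⊢C-from-empty empty (mp d e)   = mpC (⊢C-from-empty empty d) (⊢C-from-empty empty e)
⊢C-from-empty empty (hyp φ∈Γ)  = ⊥-elim (empty _ φ∈Γ)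

hyp₀ : Γ ,, A ⊢C A
hyp₀ = hyp (inj₂ refl)

hyp₁ : Γ ,, A ,, B ⊢C A
hyp₁ = hyp (inj₁ (inj₂ refl))

⇒C-refl : ∀ A → Γ ⊢C A ⇒C A
⇒C-refl A = mp (mp (c2 A (A ⇒C A) A) (c1 A (A ⇒C A))) (c1 A A)

deduction : Γ ,, A ⊢C B → Γ ⊢C A ⇒C B
deduction (c1 φ ψ)          = mp (c1 _ _) (c1 φ ψ)
deduction (c2 η φ ψ)        = mp (c1 _ _) (c2 η φ ψ)
deduction (c3 φ ψ)          = mp (c1 _ _) (c3 φ ψ)
deduction (mp d e)          = mp (mp (c2 _ _ _) (deduction d)) (deduction e)
deduction (hyp (inj₁ φ∈Γ))  = mp (c1 _ _) (hyp φ∈Γ)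
deduction (hyp (inj₂ refl)) = ⇒C-refl _

¬¬C-elim : ∀ A → Γ ⊢C ¬C ¬C A ⇒C A
¬¬C-elim A = deduction (mp (mp (c3 A (¬C A)) (mp (c1 _ _) hyp₀)) (⇒C-refl (¬C A)))

¬¬C-intro : ∀ A → Γ ⊢C A ⇒C ¬C ¬C A
¬¬C-intro A = deduction (mp (mp (c3 (¬C ¬C A) A) (¬¬C-elim (¬C A))) (mp (c1 _ _) hyp₀))

explosion : ∀ A B → Γ ⊢C ¬C A ⇒C (A ⇒C B)
explosion A B = deduction (deduction (mp (mp (c3 B A) (mp (c1 _ _) hyp₁)) (mp (c1 _ _) hyp₀)))

contraposition⁻¹ : ∀ A B → Γ ⊢C (¬C B ⇒C ¬C A) ⇒C (A ⇒C B)
contraposition⁻¹ A B = deduction (deduction (mp (mp (c3 B A) hyp₁) (mp (c1 _ _) hyp₀)))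

contraposition : ∀ A B → Γ ⊢C (A ⇒C B) ⇒C (¬C B ⇒C ¬C A)
contraposition A B = deduction (mp (contraposition⁻¹ (¬C B) (¬C A))
  (deduction (mp (¬¬C-intro B) (mp hyp₁ (mp (¬¬C-elim A) hyp₀)))))

¬C-⇒C-intro : ∀ A B → Γ ⊢C A ⇒C (¬C B ⇒C ¬C (A ⇒C B))
¬C-⇒C-intro A B = deduction (mp (contraposition (A ⇒C B) B) (deduction (mp hyp₀ hyp₁)))

by-cases : Γ ,, A ⊢C B → Γ ,, ¬C A ⊢C B → Γ ⊢C B
by-cases {A = A} {B = B} d e = mp (mp excluded-middle (deduction d)) (deduction e)
  where
  excluded-middle : Γ ⊢C (A ⇒C B) ⇒C ((¬C A ⇒C B) ⇒C B)
  excluded-middle = deduction (deduction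
    (mp (mp (c3 B (¬C A)) (mp (contraposition _ _) hyp₀)) (mp (contraposition _ _) hyp₁)))

-- A valuation is a Subset n (the set of true atoms), so anySubset? searches all of them.
Valuation : ℕ → Set
Valuation n = Vec Bool n

infixr 5 _⇒ᵇ_
_⇒ᵇ_ : Bool → Bool → Bool
a ⇒ᵇ b = not a ∨ᵇ b

evalC : Valuation n → FormC n → Bool
evalC v (atomC i) = lookup v i
evalC v (¬C φ)    = not (evalC v φ)
evalC v (φ ⇒C ψ)  = evalC v φ ⇒ᵇ evalC v ψ

Tautology : FormC n → Set
Tautology φ = ∀ v → evalC v φ ≡ true

tautology-or-falsifiable : (φ : FormC n) → Tautology φ ⊎ ∃ λ v → evalC v φ ≡ false
tautology-or-falsifiable φ with anySubset? (λ v → evalC v φ ≟ᵇ false)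
... | yes falsifiable = inj₂ falsifiable
... | no unfalsifiable = inj₁ λ v → ¬-not λ φ-false → unfalsifiable (v , φ-false)

signed : Bool → FormC n → FormC n
signed true  φ = φ
signed false φ = ¬C φ

literal : Valuation n → FormC n → FormC n
literal v φ = signed (evalC v φ) φ

kalmar : {v : Valuation n} → (∀ i → Γ ⊢C literal v (atomC i)) → ∀ φ → Γ ⊢C literal v φ
kalmar ⊢atom (atomC i) = ⊢atom i
kalmar {v = v} ⊢atom (¬C φ) with evalC v φ | kalmar {v = v} ⊢atom φ
... | true  | ⊢φ  = mp (¬¬C-intro _) ⊢φ
... | false | ⊢¬φ = ⊢¬φ
kalmar {v = v} ⊢atom (φ ⇒C ψ)
  with evalC v φ | kalmar {v = v} ⊢atom φ | evalC v ψ | kalmar {v = v} ⊢atom ψ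
... | true  | ⊢φ  | true  | ⊢ψ  = mp (c1 _ _) ⊢ψ
... | true  | ⊢φ  | false | ⊢¬ψ = mp (mp (¬C-⇒C-intro _ _) ⊢φ) ⊢¬ψ
... | false | ⊢¬φ | _     | _   = mp (explosion _ _) ⊢¬φ

literalsFrom : Valuation n → ℕ → Context n
literalsFrom v k φ = ∃ λ j → k ≤ toℕ j × literal v (atomC j) ≡ φ

literalsFrom-update : (v : Valuation n) (k<n : k < n) (b : Bool) →
  literalsFrom (v [ fromℕ< k<n ]≔ b) k ⊆ literalsFrom v (suc k) ,, signed b (atomC (fromℕ< k<n))
literalsFrom-update {k = k} v k<n b (j , k≤j , refl) with fromℕ< k<n ≟ᶠ j
... | yes refl = inj₂ (cong (λ c → signed c (atomC j)) (sym (lookup∘update j v b)))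
... | no i≢j   = inj₁ (j , ≤∧≢⇒< k≤j k≢j , cong (λ c → signed c (atomC j)) (sym v[i]≔b[j]≡v[j]))
  where
  k≢j : k ≡ toℕ j → ⊥
  k≢j k≡j = i≢j (toℕ-injective (trans (toℕ-fromℕ< k<n) k≡j))
  v[i]≔b[j]≡v[j] : lookup (v [ fromℕ< k<n ]≔ b) j ≡ lookup v j
  v[i]≔b[j]≡v[j] = lookup∘update′ (λ j≡i → i≢j (sym j≡i)) v b

eliminate-literal : {φ : FormC n} → k < n →
  (∀ v → literalsFrom v k ⊢C φ) → ∀ v → literalsFrom v (suc k) ⊢C φ
eliminate-literal k<n ⊢φ v = by-cases
  (⊢C-weaken (literalsFrom-update v k<n true) (⊢φ (v [ fromℕ< k<n ]≔ true)))
  (⊢C-weaken (literalsFrom-update v k<n false) (⊢φ (v [ fromℕ< k<n ]≔ false)))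

tautology-from-literals : {φ : FormC n} → Tautology φ →
  ∀ k → k ≤ n → ∀ v → literalsFrom v k ⊢C φ
tautology-from-literals {φ = φ} taut zero _ v =
  subst (λ b → literalsFrom v 0 ⊢C signed b φ) (taut v) (kalmar (λ j → hyp (j , z≤n , refl)) φ)
tautology-from-literals taut (suc k) k<n =
  eliminate-literal k<n (tautology-from-literals taut k (<⇒≤ k<n))

completeness : Tautology φ → ⊢C φ
completeness taut = ⊢C-from-empty (λ { _ (j , n≤j , _) → <⇒≱ (toℕ<n j) n≤j })
  (tautology-from-literals taut _ ≤-refl (replicate _ false))

Truth : Set
Truth = Bool × Bool

valid : Truth → Bool
valid (a₁ , a₀) = a₁ ∧ᵇ a₀

infixr 20 ¬ᵗ_ □ᵗ_
infixr 10 _⇒ᵗ_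
infixr 12 _∨ᵗ_
infixr 13 _∧ᵗ_
infix 8 _⇔ᵗ_ _×ᵗ_

¬ᵗ_ : Truth → Truth
¬ᵗ (a₁ , a₀) = not a₁ , not a₀

_⇒ᵗ_ : Truth → Truth → Truth
(a₁ , a₀) ⇒ᵗ (b₁ , b₀) = a₁ ⇒ᵇ b₁ , a₀ ⇒ᵇ b₀

□ᵗ_ : Truth → Truth
□ᵗ p = valid p , valid p

-- A truth value lists the values in world 1 and world 0; (q ∣ᵗ p) reads q at the nearest
-- p-world: the world itself if p holds there, otherwise the other world if p holds there.
_∣ᵗ_ : Truth → Truth → Truth
(b₁ , b₀) ∣ᵗ (a₁ , a₀) = (if a₁ then b₁ else if a₀ then b₀ else b₁)
                       , (if a₀ then b₀ else if a₁ then b₁ else b₀)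

_∨ᵗ_ : Truth → Truth → Truth
p ∨ᵗ q = ¬ᵗ p ⇒ᵗ q

_∧ᵗ_ : Truth → Truth → Truth
p ∧ᵗ q = ¬ᵗ (¬ᵗ p ∨ᵗ ¬ᵗ q)

_⇔ᵗ_ : Truth → Truth → Truth
p ⇔ᵗ q = (p ⇒ᵗ q) ∧ᵗ (q ⇒ᵗ p)

_×ᵗ_ : Truth → Truth → Truth
q ×ᵗ p = □ᵗ ((q ∣ᵗ p) ⇔ᵗ q)

valid-mp : ∀ p q → valid (p ⇒ᵗ q) ≡ true → valid p ≡ true → valid q ≡ true
valid-mp (true  , true)  _ ⊨p⇒q _ = ⊨p⇒q
valid-mp (true  , false) _ _ ()
valid-mp (false , _)     _ _ ()

valid-□ : ∀ p → valid p ≡ true → valid (□ᵗ p) ≡ true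
valid-□ p ⊨p = cong (λ b → b ∧ᵇ b) ⊨p

pairUp : ∀ k → Vec Bool (k * 2) → Vec Truth k
pairUp zero    []             = []
pairUp (suc k) (a₁ ∷ a₀ ∷ bs) = (a₁ , a₀) ∷ pairUp k bs

flatten : Vec Truth k → Vec Bool (k * 2)
flatten []               = []
flatten ((a₁ , a₀) ∷ ts) = a₁ ∷ a₀ ∷ flatten ts

pairUp-flatten : (ts : Vec Truth k) → pairUp k (flatten ts) ≡ ts
pairUp-flatten []       = refl
pairUp-flatten (t ∷ ts) = cong (t ∷_) (pairUp-flatten ts)

-- The implicit argument is discharged by evaluation, running through all 2^(2k) rows.
truth-table : (f : Vec Truth k → Truth) →
  {False (anySubset? λ bs → valid (f (pairUp k bs)) ≟ᵇ false)} → ∀ ts → valid (f ts) ≡ true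
truth-table f {no-counterexample} ts = ¬-not λ ⊭fts →
  toWitnessFalse no-counterexample
    (flatten ts , subst (λ ts′ → valid (f ts′) ≡ false) (sym (pairUp-flatten ts)) ⊭fts)

module TwoWorldModel {n : ℕ} (θ₀ : Fin n) (v₁ v₀ : Valuation n) where
  open Abbrev θ₀

  ⟦_⟧ : Form n → Truth
  ⟦ atom i ⟧    = lookup v₁ i , lookup v₀ i
  ⟦ ¬ φ ⟧       = ¬ᵗ ⟦ φ ⟧
  ⟦ □ φ ⟧       = □ᵗ ⟦ φ ⟧
  ⟦ φ ⇒ ψ ⟧     = ⟦ φ ⟧ ⇒ᵗ ⟦ ψ ⟧
  ⟦ cond ψ φ ⟧  = ⟦ ψ ⟧ ∣ᵗ ⟦ φ ⟧

  sound : ∀ {χ} → ⊢ χ → valid ⟦ χ ⟧ ≡ true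
  sound (c1 φ ψ) = truth-table
    (λ { (p ∷ q ∷ []) → p ⇒ᵗ (q ⇒ᵗ p) }) (⟦ φ ⟧ ∷ ⟦ ψ ⟧ ∷ [])
  sound (c2 η φ ψ) = truth-table
    (λ { (e ∷ p ∷ q ∷ []) → (e ⇒ᵗ (p ⇒ᵗ q)) ⇒ᵗ ((e ⇒ᵗ p) ⇒ᵗ (e ⇒ᵗ q)) })
    (⟦ η ⟧ ∷ ⟦ φ ⟧ ∷ ⟦ ψ ⟧ ∷ [])
  sound (c3 φ ψ) = truth-table
    (λ { (p ∷ q ∷ []) → (¬ᵗ p ⇒ᵗ ¬ᵗ q) ⇒ᵗ ((¬ᵗ p ⇒ᵗ q) ⇒ᵗ p) }) (⟦ φ ⟧ ∷ ⟦ ψ ⟧ ∷ [])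
  sound (m2 φ ψ) = truth-table
    (λ { (p ∷ q ∷ []) → □ᵗ (p ⇒ᵗ q) ⇒ᵗ (□ᵗ p ⇒ᵗ □ᵗ q) }) (⟦ φ ⟧ ∷ ⟦ ψ ⟧ ∷ [])
  sound (m3 φ) = truth-table
    (λ { (p ∷ []) → □ᵗ p ⇒ᵗ p }) (⟦ φ ⟧ ∷ [])
  sound (b1 φ ψ) = truth-table
    (λ { (p ∷ q ∷ []) → □ᵗ (p ⇒ᵗ q) ⇒ᵗ (□ᵗ ¬ᵗ p ∨ᵗ □ᵗ (q ∣ᵗ p)) }) (⟦ φ ⟧ ∷ ⟦ ψ ⟧ ∷ [])
  sound (b2 φ ψ η) = truth-table
    (λ { (p ∷ q ∷ e ∷ []) → ((q ⇒ᵗ e) ∣ᵗ p) ⇒ᵗ ((q ∣ᵗ p) ⇒ᵗ (e ∣ᵗ p)) })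
    (⟦ φ ⟧ ∷ ⟦ ψ ⟧ ∷ ⟦ η ⟧ ∷ [])
  sound (b3 φ ψ) = truth-table
    (λ { (p ∷ q ∷ []) → (q ∣ᵗ p) ⇒ᵗ (p ⇒ᵗ q) }) (⟦ φ ⟧ ∷ ⟦ ψ ⟧ ∷ [])
  sound (b4 φ ψ) = truth-table
    (λ { (p ∷ q ∷ []) → ¬ᵗ ((¬ᵗ q) ∣ᵗ p) ⇔ᵗ (q ∣ᵗ p) }) (⟦ φ ⟧ ∷ ⟦ ψ ⟧ ∷ [])
  -- q ×ᵗ p is valid exactly when p or q is constant across the worlds, a symmetric condition.
  sound (b5 φ ψ) = truth-table
    (λ { (p ∷ q ∷ []) → (q ×ᵗ p) ⇔ᵗ (p ×ᵗ q) }) (⟦ φ ⟧ ∷ ⟦ ψ ⟧ ∷ [])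
  sound (mp {φ} {ψ} ⊢φ⇒ψ ⊢φ) = valid-mp ⟦ φ ⟧ ⟦ ψ ⟧ (sound ⊢φ⇒ψ) (sound ⊢φ)
  sound (nec {φ} ⊢φ) = valid-□ ⟦ φ ⟧ (sound ⊢φ)

  ⟦emb⟧≡evalC : ∀ φ → ⟦ emb φ ⟧ ≡ (evalC v₁ φ , evalC v₀ φ)
  ⟦emb⟧≡evalC (atomC i) = refl
  ⟦emb⟧≡evalC (¬C φ) rewrite ⟦emb⟧≡evalC φ = refl
  ⟦emb⟧≡evalC (φ ⇒C ψ) rewrite ⟦emb⟧≡evalC φ | ⟦emb⟧≡evalC ψ = refl

  contingent⇒⊬□∨□¬ : ∀ {φ} → evalC v₁ φ ≡ true → evalC v₀ φ ≡ false →
                     ⊢ □ emb φ ∨ □ ¬ emb φ → ⊥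
  contingent⇒⊬□∨□¬ {φ} v₁⊨φ v₀⊭φ ⊢□φ∨□¬φ
    with subst (λ p → valid (□ᵗ p ∨ᵗ □ᵗ ¬ᵗ p) ≡ true)
               (trans (⟦emb⟧≡evalC φ) (cong₂ _,_ v₁⊨φ v₀⊭φ)) (sound ⊢□φ∨□¬φ)
  ... | ()

mainTheorem15 : (n : ℕ) (θ₀ : Fin n) (φ : FormC n) →
    Abbrev.⊢_ θ₀ (Abbrev._∨_ θ₀ (□ emb φ) (□ ¬ emb φ)) →
    (⊢C φ) ⊎ (⊢C (¬C φ))
mainTheorem15 n θ₀ φ ⊢□φ∨□¬φ with tautology-or-falsifiable φ | tautology-or-falsifiable (¬C φ)
... | inj₁ φ-taut | _            = inj₁ (completeness φ-taut)
... | inj₂ _      | inj₁ ¬φ-taut = inj₂ (completeness ¬φ-taut)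
... | inj₂ (v₀ , v₀⊭φ) | inj₂ (v₁ , v₁⊭¬φ) =
  ⊥-elim (TwoWorldModel.contingent⇒⊬□∨□¬ θ₀ v₁ v₀ (not-injective v₁⊭¬φ) v₀⊭φ ⊢□φ∨□¬φ)
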